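{- Let $d \geq 2$ and $n_1,\dots,n_d \geq 1$ be integers, and let $G_1$ and $G_2$ be graphs. Then $K_{n_1,\dots,n_d}$ is a subgraph of $G_1\boxtimes G_2$ if and only if there exist non-negative integers $a_1,\dots,a_d,b_1,\dots,b_d,z_1,\dots,z_d,x,y$ such that: (i) $K_{a_1,\dots,a_d,\overline{x}}$ is a subgraph of $G_1$; (ii) $K_{b_1,\dots,b_d,\overline{y}}$ is a subgraph of $G_2$; (iii) $n_j \leq a_jb_j+a_jy+b_jx+z_j$ for all $j\in\{1,\dots,d\}$; and (iv) $z_1+\dots+z_d\leq xy$.
   Context: All graphs are finite and simple; "subgraph" means a subgraph isomorphic to the given graph. The strong product $G_1\boxtimes G_2$ has vertex set $V(G_1)\times V(G_2)$, with distinct $(a,v),(b,u)$ adjacent iff ($a=b$ and $uv\in E(G_2)$) or ($ab\in E(G_1)$ and $u=v$) or ($ab\in E(G_1)$ and $uv\in E(G_2)$). $K_{n_1,\dots,n_d}$ denotes the complete $d$-partite graph with parts of sizes $n_1,\dots,n_d$. For non-negative integers $a_1,\dots,a_d,x$, the graph $K_{a_1,\dots,a_d,\overline{x}}$ has vertex set $A_1\cup\dots\cup A_d\cup X$, pairwise disjoint sets with $|A_j|=a_j$ and $|X|=x$; two distinct vertices are adjacent iff they lie in different sets among $A_1,\dots,A_d,X$, or both lie in $X$ (so $X$ is a clique and each $A_j$ is independent). -}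

module Defs where

open import Data.Nat using (ℕ; zero; suc; _+_; _*_)
open import Data.Bool using (Bool; true; false; _∧_; _∨_; not; T)
open import Data.Bool.Properties using (∧-comm; ∨-comm)
open import Data.Fin using (Fin; splitAt; remQuot; _≟_)
open import Data.Fin.Properties using ()
open import Data.Vec using (Vec; []; _∷_; sum)
open import Data.Maybe using (Maybe; just; nothing)
open import Data.Sum using (inj₁; inj₂)
open import Data.Product using (Σ; _×_; _,_)
open import Function.Definitions using (Injective)
open import Relation.Nullary using (yes; no)
open import Relation.Nullary.Decidable using (⌊_⌋)
open import Relation.Binary.PropositionalEquality using (_≡_; refl; sym; cong; cong₂)

record Graph : Set where
  field
    order  : ℕ
    adj    : Fin order → Fin order → Bool
    adj-sym    : ∀ u v → adj u v ≡ adj v u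
    adj-irrefl : ∀ u → adj u u ≡ false
open Graph public

Adj : (G : Graph) → Fin (order G) → Fin (order G) → Set
Adj G u v = T (adj G u v)

_⊆_ : Graph → Graph → Set
H ⊆ G = Σ (Fin (order H) → Fin (order G)) λ f →
          Injective _≡_ _≡_ f × (∀ u v → Adj H u v → Adj G (f u) (f v))

eqF : ∀ {n} → Fin n → Fin n → Bool
eqF u v = ⌊ u ≟ v ⌋

eqF-sym : ∀ {n} (u v : Fin n) → eqF u v ≡ eqF v u
eqF-sym u v with u ≟ v | v ≟ u
... | yes _ | yes _ = refl
... | no _  | no _  = refl
... | yes p | no q  = Data.Empty.⊥-elim (q (sym p)) where import Data.Empty
... | no p  | yes q = Data.Empty.⊥-elim (p (sym q)) where import Data.Empty

eqF-refl : ∀ {n} (u : Fin n) → eqF u u ≡ true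
eqF-refl u with u ≟ u
... | yes _ = refl
... | no p  = Data.Empty.⊥-elim (p refl) where import Data.Empty

⊠-adjP : (G₁ G₂ : Graph) → Fin (order G₁) × Fin (order G₂)
       → Fin (order G₁) × Fin (order G₂) → Bool
⊠-adjP G₁ G₂ (a , v) (b , u) =
  (eqF a b ∧ adj G₂ v u) ∨ (adj G₁ a b ∧ eqF v u) ∨ (adj G₁ a b ∧ adj G₂ v u)

private
  ⊠-adjP-sym : ∀ G₁ G₂ p q → ⊠-adjP G₁ G₂ p q ≡ ⊠-adjP G₁ G₂ q p
  ⊠-adjP-sym G₁ G₂ (a , v) (b , u)
    rewrite eqF-sym a b | eqF-sym v u | adj-sym G₁ a b | adj-sym G₂ v u = refl

  ⊠-adjP-irrefl : ∀ G₁ G₂ p → ⊠-adjP G₁ G₂ p p ≡ false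
  ⊠-adjP-irrefl G₁ G₂ (a , v)
    rewrite adj-irrefl G₁ a | adj-irrefl G₂ v | Data.Bool.Properties.∧-zeroʳ (eqF a a) = refl
    where import Data.Bool.Properties

_⊠_ : Graph → Graph → Graph
G₁ ⊠ G₂ = record
  { order = order G₁ * order G₂
  ; adj = λ i j → ⊠-adjP G₁ G₂ (remQuot (order G₂) i) (remQuot (order G₂) j)
  ; adj-sym = λ i j → ⊠-adjP-sym G₁ G₂ (remQuot (order G₂) i) (remQuot (order G₂) j)
  ; adj-irrefl = λ i → ⊠-adjP-irrefl G₁ G₂ (remQuot (order G₂) i)
  }

-- K_{a₁,…,a_d, x̄}: vertices Fin (a₁ + … + a_d + x); the first a₁ vertices
-- form A₁, the next a₂ form A₂, …, the last x form the clique X.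

partOf : ∀ {d} (as : Vec ℕ d) → Fin (sum as) → Fin d
partOf (a ∷ as) i with splitAt a i
... | inj₁ _ = Fin.zero where import Data.Fin as Fin
... | inj₂ j = Fin.suc (partOf as j) where import Data.Fin as Fin

-- label: just j  = vertex in A_j ;  nothing = vertex in X
label : ∀ {d} (as : Vec ℕ d) (x : ℕ) → Fin (sum as + x) → Maybe (Fin d)
label as x i with splitAt (sum as) i
... | inj₁ j = just (partOf as j)
... | inj₂ _ = nothing

sameA : ∀ {d} → Maybe (Fin d) → Maybe (Fin d) → Bool
sameA (just i) (just j) = eqF i j
sameA _        _        = false

private
  sameA-sym : ∀ {d} (p q : Maybe (Fin d)) → sameA p q ≡ sameA q p
  sameA-sym (just i) (just j) = eqF-sym i j
  sameA-sym (just i) nothing  = refl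
  sameA-sym nothing  (just j) = refl
  sameA-sym nothing  nothing  = refl

Kx : ∀ {d} → Vec ℕ d → ℕ → Graph
Kx as x = record
  { order = sum as + x
  ; adj = λ u v → not (eqF u v) ∧ not (sameA (label as x u) (label as x v))
  ; adj-sym = λ u v → cong₂ (λ s t → not s ∧ not t) (eqF-sym u v)
                        (sameA-sym (label as x u) (label as x v))
  ; adj-irrefl = λ u → helper u
  }
  where
  helper : ∀ u → not (eqF u u) ∧ not (sameA (label as x u) (label as x u)) ≡ false
  helper u rewrite eqF-refl u = refl

K : ∀ {d} → Vec ℕ d → Graph
K ns = Kx ns 0

-- Project an embedding of K_{n₁,…,n_d} into G₁ ⊠ G₂ onto G₁: vertices from different parts
-- land on equal or adjacent vertices. The vertices of G₁ hit by two different parts form a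
-- clique X, those hit by part j alone an independent set A_j, and together they span a copy of
-- K_{a₁,…,a_d,x̄} in G₁; likewise B_j and Y in G₂. A vertex of part j is determined by its pair
-- of projections in (A_j ∪ X) × (B_j ∪ Y); at most a_j b_j + a_j y + b_j x of these pairs avoid
-- X × Y, and the z_j pairs inside X × Y are distinct across all parts, so Σ z_j ≤ x y.
-- Conversely, inject each part j into (A_j ∪ X) × (B_j ∪ Y), sharing out the cells of X × Y
-- according to the z_j: pairs from different parts are distinct and coordinatewise equal or
-- adjacent, hence adjacent in the strong product.

module Submission where

open import Defs
open import Axiom.UniquenessOfIdentityProofs.WithK using (uip)
open import Data.Bool using (_∧_; not; T)
open import Data.Bool.Properties using (T-∧; T-∨)
open import Data.Empty using (⊥-elim)
open import Data.Fin using (Fin; zero; suc; splitAt; join; remQuot; combine; _↑ˡ_; _↑ʳ_; _≟_; inject≤)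
open import Data.Fin.Properties
  using (+↔⊎; *↔×; suc-injective; inject≤-injective; combine-injective; injective⇒≤; any?;
         splitAt-↑ˡ; splitAt-↑ʳ; splitAt-join; join-splitAt; remQuot-combine; combine-remQuot)
open import Data.Maybe using (Maybe; just; nothing)
open import Data.Maybe.Properties using (just-injective)
open import Data.Nat using (ℕ; zero; suc; _+_; _*_; _≤_)
open import Data.Product using (Σ; ∃; ∃₂; _×_; _,_; proj₁; proj₂; uncurry)
import Data.Product as Product
open import Data.Product.Properties using (,-injectiveˡ; ,-injectiveʳ-UIP)
open import Data.Sum using (_⊎_; inj₁; inj₂; [_,_])
import Data.Sum as Sum
open import Data.Sum.Function.Propositional using (_⊎-↔_)
open import Data.Sum.Properties using (inj₁-injective; inj₂-injective)
open import Data.Unit using (⊤; tt)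
open import Data.Vec using (Vec; _∷_; lookup; sum; tabulate)
open import Data.Vec.Properties using (lookup∘tabulate)
open import Function using (_∘_; id; const; _∋_)
open import Function.Bundles using (_⇔_; mk⇔; Equivalence; _↣_; _↔_; Injection)
open import Function.Consequences.Propositional using (inverseʳ⇒injective; strictlyInverseʳ⇒inverseʳ)
open import Function.Definitions using (Injective; StrictlyInverseʳ)
open import Function.Properties.Inverse using (↔-trans; ↔-sym; ↔⇒↣)
open import Relation.Binary.Construct.Closure.Reflexive
  using (ReflClosure; reflexive) renaming (refl to same; [_] to edge; map to mapReflClosure)
open import Relation.Binary.PropositionalEquality
  using (_≡_; _≢_; refl; sym; trans; cong; cong₂; subst; subst₂)
open import Relation.Nullary using (¬_; Dec; yes; no)
open import Relation.Nullary.Decidable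
  using (¬?; _×-dec_; toWitness; fromWitness; toWitnessFalse; fromWitnessFalse)

open Equivalence using (to; from)
open Injection using () renaming (to to apply; injective to apply-injective)

strictlyInverseʳ⇒injective : ∀ {A B : Set} (f : A → B) (g : B → A) → StrictlyInverseʳ _≡_ f g →
                             Injective _≡_ _≡_ f
strictlyInverseʳ⇒injective f g g∘f≡id =
  inverseʳ⇒injective {f⁻¹ = g} f (strictlyInverseʳ⇒inverseʳ f g∘f≡id)

splitAt-injective : ∀ m {n} → Injective _≡_ _≡_ (splitAt m {n})
splitAt-injective m {n} = strictlyInverseʳ⇒injective (splitAt m) (join m n) (join-splitAt m n)

Part : ∀ {d} → Vec ℕ d → Set
Part {d} ms = Σ (Fin d) λ j → Fin (lookup ms j)

fromPart : ∀ {d} (ms : Vec ℕ d) → Part ms → Fin (sum ms)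
fromPart (m ∷ ms) (zero , α) = α ↑ˡ sum ms
fromPart (m ∷ ms) (suc j , β) = m ↑ʳ fromPart ms (j , β)

toPart : ∀ {d} (ms : Vec ℕ d) → Fin (sum ms) → Part ms
toPart (m ∷ ms) = [ zero ,_ , Product.map suc id ∘ toPart ms ] ∘ splitAt m

toPart-fromPart : ∀ {d} (ms : Vec ℕ d) p → toPart ms (fromPart ms p) ≡ p
toPart-fromPart (m ∷ ms) (zero , α) rewrite splitAt-↑ˡ m α (sum ms) = refl
toPart-fromPart (m ∷ ms) (suc j , β)
  rewrite splitAt-↑ʳ m (sum ms) (fromPart ms (j , β)) | toPart-fromPart ms (j , β) = refl

fromPart-toPart : ∀ {d} (ms : Vec ℕ d) i → fromPart ms (toPart ms i) ≡ i
fromPart-toPart (m ∷ ms) i with splitAt m i in eq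
... | inj₁ α = trans (cong (join m (sum ms)) (sym eq)) (join-splitAt m (sum ms) i)
... | inj₂ r = trans (cong (m ↑ʳ_) (fromPart-toPart ms r))
                     (trans (cong (join m (sum ms)) (sym eq)) (join-splitAt m (sum ms) i))

fromPart-injective : ∀ {d} (ms : Vec ℕ d) → Injective _≡_ _≡_ (fromPart ms)
fromPart-injective ms = strictlyInverseʳ⇒injective (fromPart ms) (toPart ms) (toPart-fromPart ms)

toPart-injective : ∀ {d} (ms : Vec ℕ d) → Injective _≡_ _≡_ (toPart ms)
toPart-injective ms = strictlyInverseʳ⇒injective (toPart ms) (fromPart ms) (fromPart-toPart ms)

partOf-fromPart : ∀ {d} (ms : Vec ℕ d) p → partOf ms (fromPart ms p) ≡ proj₁ p
partOf-fromPart (m ∷ ms) (zero , α) rewrite splitAt-↑ˡ m α (sum ms) = refl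
partOf-fromPart (m ∷ ms) (suc j , β)
  rewrite splitAt-↑ʳ m (sum ms) (fromPart ms (j , β)) = cong suc (partOf-fromPart ms (j , β))

record Enumeration {n} (P : Fin n → Set) (size : ℕ) : Set where
  field
    enum : Fin size → Fin n
    enum-injective : Injective _≡_ _≡_ enum
    enum-∈ : ∀ i → P (enum i)
    index : ∀ k → P k → Fin size
    enum-index : ∀ k p → enum (index k p) ≡ k

module _ {n} {P : Fin (suc n) → Set} {m} (E : Enumeration (P ∘ suc) m) where
  open Enumeration E

  enumeration-with-zero : P zero → Enumeration P (suc m)
  enumeration-with-zero p₀ = record
    { enum = λ { zero → zero ; (suc i) → suc (enum i) }
    ; enum-injective = λ { {zero} {zero} _ → refl ; {zero} {suc _} () ; {suc _} {zero} ()
                         ; {suc _} {suc _} eq → cong suc (enum-injective (suc-injective eq)) }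
    ; enum-∈ = λ { zero → p₀ ; (suc i) → enum-∈ i }
    ; index = λ { zero _ → zero ; (suc k) p → suc (index k p) }
    ; enum-index = λ { zero _ → refl ; (suc k) p → cong suc (enum-index k p) }
    }

  enumeration-without-zero : ¬ P zero → Enumeration P m
  enumeration-without-zero ¬p₀ = record
    { enum = suc ∘ enum
    ; enum-injective = λ eq → enum-injective (suc-injective eq)
    ; enum-∈ = enum-∈
    ; index = λ { zero p → ⊥-elim (¬p₀ p) ; (suc k) p → index k p }
    ; enum-index = λ { zero p → ⊥-elim (¬p₀ p) ; (suc k) p → cong suc (enum-index k p) }
    }

enumerate : ∀ {n} {P : Fin n → Set} → (∀ k → Dec (P k)) → Σ ℕ (Enumeration P)
enumerate {zero} P? = 0 , record
  { enum = λ () ; enum-injective = λ { {()} } ; enum-∈ = λ () ; index = λ () ; enum-index = λ () }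
enumerate {suc n} P? with enumerate (P? ∘ suc) | P? zero
... | m , E | yes p₀ = suc m , enumeration-with-zero E p₀
... | m , E | no ¬p₀ = m , enumeration-without-zero E ¬p₀

IsInj₂ : ∀ {A B : Set} → A ⊎ B → Set
IsInj₂ {B = B} s = Σ B λ b → s ≡ inj₂ b

isInj₂? : ∀ {A B : Set} (s : A ⊎ B) → Dec (IsInj₂ s)
isInj₂? (inj₁ _) = no λ ()
isInj₂? (inj₂ b) = yes (b , refl)

injective-⊎⇒≤ : ∀ {n m z} {A B : Set} {f : Fin n → A ⊎ B} → Injective _≡_ _≡_ f →
                A ↣ Fin m → Enumeration (IsInj₂ ∘ f) z → n ≤ m + z
injective-⊎⇒≤ {n} {m} {z} {f = f} f-injective ι E =
  injective⇒≤ {f = λ k → join m z (route k (f k) refl)}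
    (λ eq → route-injective _ _ refl refl (join-injective eq))
  where
  open Enumeration E
  route : ∀ k s → f k ≡ s → Fin m ⊎ Fin z
  route k (inj₁ a) _ = inj₁ (apply ι a)
  route k (inj₂ b) e = inj₂ (index k (b , e))

  join-injective : Injective _≡_ _≡_ (join m z)
  join-injective = strictlyInverseʳ⇒injective (join m z) (splitAt m) (splitAt-join m z)

  route-injective : ∀ {k k′} s s′ (e : f k ≡ s) (e′ : f k′ ≡ s′) →
                    route k s e ≡ route k′ s′ e′ → k ≡ k′
  route-injective (inj₁ a) (inj₁ a′) e e′ eq =
    f-injective (trans e (trans (cong inj₁ (apply-injective ι (inj₁-injective eq))) (sym e′)))
  route-injective {k} {k′} (inj₂ b) (inj₂ b′) e e′ eq =
    trans (sym (enum-index k _)) (trans (cong enum (inj₂-injective eq)) (enum-index k′ _))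

tagged : ∀ {d} {A C : Fin d → Set} {B : Set} →
         (∀ j → A j → C j ⊎ B) → Σ (Fin d) A → Σ (Fin d) C ⊎ B
tagged f (j , k) = Sum.map₁ (j ,_) (f j k)

tagged-injectiveʳ : ∀ {d} {A C : Fin d → Set} {B : Set} (f : ∀ j → A j → C j ⊎ B) →
                    Injective _≡_ _≡_ (tagged f) → ∀ j → Injective _≡_ _≡_ (f j)
tagged-injectiveʳ f f-injective j {k} {k′} eq =
  ,-injectiveʳ-UIP uip (f-injective {j , k} {j , k′} (cong (Sum.map₁ (j ,_)) eq))

-- Counting and Packing are converse: a part-preserving injection Σ_j Fin (n j) → Σ_j C j ⊎ B
-- exists iff n j ≤ |C j| + z_j for some z with Σ_j z_j ≤ |B|.
module Counting {d} {C : Fin d → Set} {B : Set} {n m : Fin d → ℕ} {N : ℕ}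
  (ι : ∀ j → C j ↣ Fin (m j)) (ζ : B ↣ Fin N)
  (f : ∀ j → Fin (n j) → C j ⊎ B) (f-injective : Injective _≡_ _≡_ (tagged f)) where

  private
    sharedCount : Fin d → ℕ
    sharedCount j = proj₁ (enumerate (isInj₂? ∘ f j))

  open Enumeration using (enum; enum-∈; enum-injective)

  zs : Vec ℕ d
  zs = tabulate sharedCount

  shared : ∀ j → Enumeration (IsInj₂ ∘ f j) (lookup zs j)
  shared j = subst (Enumeration _) (sym (lookup∘tabulate sharedCount j))
                   (proj₂ (enumerate (isInj₂? ∘ f j)))

  n≤m+zs : ∀ j → n j ≤ m j + lookup zs j
  n≤m+zs j = injective-⊎⇒≤ (tagged-injectiveʳ f f-injective j) (ι j) (shared j)

  sharedImage : Part zs → B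
  sharedImage (j , r) = proj₁ (enum-∈ (shared j) r)

  tagged-shared : ∀ j r → tagged f (j , enum (shared j) r) ≡ inj₂ (sharedImage (j , r))
  tagged-shared j r = cong (Sum.map₁ (j ,_)) (proj₂ (enum-∈ (shared j) r))

  sharedImage-injective : Injective _≡_ _≡_ sharedImage
  sharedImage-injective {j , r} {j′ , r′} eq
    with same-vertex ← f-injective {j , enum (shared j) r} {j′ , enum (shared j′) r′}
                         (trans (tagged-shared j r) (trans (cong inj₂ eq) (sym (tagged-shared j′ r′))))
    with refl ← ,-injectiveˡ same-vertex
    = cong (j ,_) (enum-injective (shared j) (,-injectiveʳ-UIP uip same-vertex))

  sum-zs≤N : sum zs ≤ N
  sum-zs≤N = injective⇒≤ {f = apply ζ ∘ sharedImage ∘ toPart zs}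
    (λ eq → toPart-injective zs (sharedImage-injective (apply-injective ζ eq)))

module Packing {d} {C : Fin d → Set} {B : Set} {n m : Fin d → ℕ} {zs : Vec ℕ d} {N : ℕ}
  (ι : ∀ j → Fin (m j) ↣ C j) (ζ : Fin N ↣ B)
  (n≤m+zs : ∀ j → n j ≤ m j + lookup zs j) (sum-zs≤N : sum zs ≤ N) where

  shared : Part zs → B
  shared p = apply ζ (inject≤ (fromPart zs p) sum-zs≤N)

  slot : ∀ j → Fin (n j) → Fin (m j) ⊎ Fin (lookup zs j)
  slot j k = splitAt (m j) (inject≤ k (n≤m+zs j))

  place : ∀ j → Fin (m j) ⊎ Fin (lookup zs j) → C j ⊎ B
  place j = Sum.map (apply (ι j)) (shared ∘ (j ,_))

  pack : ∀ j → Fin (n j) → C j ⊎ B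
  pack j = place j ∘ slot j

  place-injective : ∀ {j j′} s s′ → Sum.map₁ (j ,_) (place j s) ≡ Sum.map₁ (j′ ,_) (place j′ s′) →
    (Σ (Fin d) (λ j → Fin (m j) ⊎ Fin (lookup zs j)) ∋ (j , s)) ≡ (j′ , s′)
  place-injective {j} (inj₁ u) (inj₁ u′) eq with refl ← ,-injectiveˡ (inj₁-injective eq) =
    cong (λ u → j , inj₁ u) (apply-injective (ι j) (,-injectiveʳ-UIP uip (inj₁-injective eq)))
  place-injective (inj₂ r) (inj₂ r′) eq
    with refl ← fromPart-injective zs (inject≤-injective _ _ _ _ (apply-injective ζ (inj₂-injective eq)))
    = refl

  pack-injective : Injective _≡_ _≡_ (tagged pack)
  pack-injective {j , k} {j′ , k′} eq
    with same-slot ← place-injective (slot j k) (slot j′ k′) eq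
    with refl ← ,-injectiveˡ same-slot
    = cong (j ,_) (inject≤-injective _ _ _ _
                     (splitAt-injective (m j) (,-injectiveʳ-UIP uip same-slot)))

Adj⁼ : (G : Graph) → Fin (order G) → Fin (order G) → Set
Adj⁼ G = ReflClosure (Adj G)

Adj⁼⇒Adj : ∀ {G a b} → Adj⁼ G a b → a ≢ b → Adj G a b
Adj⁼⇒Adj same a≢a = ⊥-elim (a≢a refl)
Adj⁼⇒Adj (edge ab) _ = ab

⊆-Adj⁼ : ∀ {H G} (E : H ⊆ G) {u v} → Adj⁼ H u v → Adj⁼ G (proj₁ E u) (proj₁ E v)
⊆-Adj⁼ E = mapReflClosure (proj₂ (proj₂ E) _ _)

module KxVertices {d} (as : Vec ℕ d) (x : ℕ) where

  KxVertex : Set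
  KxVertex = Part as ⊎ Fin x

  toKx : KxVertex → Fin (sum as + x)
  toKx = join (sum as) x ∘ Sum.map₁ (fromPart as)

  fromKx : Fin (sum as + x) → KxVertex
  fromKx = Sum.map₁ (toPart as) ∘ splitAt (sum as)

  toKx-fromKx : ∀ i → toKx (fromKx i) ≡ i
  toKx-fromKx i with splitAt (sum as) i in eq
  ... | inj₁ r = trans (cong (_↑ˡ x) (fromPart-toPart as r))
                       (trans (cong (join (sum as) x) (sym eq)) (join-splitAt (sum as) x i))
  ... | inj₂ s = trans (cong (join (sum as) x) (sym eq)) (join-splitAt (sum as) x i)

  fromKx-toKx : ∀ v → fromKx (toKx v) ≡ v
  fromKx-toKx (inj₁ p) rewrite splitAt-↑ˡ (sum as) (fromPart as p) x = cong inj₁ (toPart-fromPart as p)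
  fromKx-toKx (inj₂ s) rewrite splitAt-↑ʳ (sum as) x s = refl

  toKx-injective : Injective _≡_ _≡_ toKx
  toKx-injective = strictlyInverseʳ⇒injective toKx fromKx fromKx-toKx

  fromKx-injective : Injective _≡_ _≡_ fromKx
  fromKx-injective = strictlyInverseʳ⇒injective fromKx toKx toKx-fromKx

  part : KxVertex → Maybe (Fin d)
  part = [ just ∘ proj₁ , const nothing ]

  label-toKx : ∀ v → label as x (toKx v) ≡ part v
  label-toKx (inj₁ p) rewrite splitAt-↑ˡ (sum as) (fromPart as p) x = cong just (partOf-fromPart as p)
  label-toKx (inj₂ s) rewrite splitAt-↑ʳ (sum as) x s = refl

  Apart : KxVertex → KxVertex → Set
  Apart (inj₁ (j , _)) (inj₁ (j′ , _)) = j ≢ j′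
  Apart _ _ = ⊤

  Apart⇔ : ∀ v w → Apart v w ⇔ T (not (sameA (part v) (part w)))
  Apart⇔ (inj₁ _) (inj₁ _) = mk⇔ fromWitnessFalse toWitnessFalse
  Apart⇔ (inj₁ _) (inj₂ _) = mk⇔ id id
  Apart⇔ (inj₂ _) (inj₁ _) = mk⇔ id id
  Apart⇔ (inj₂ _) (inj₂ _) = mk⇔ id id

  Kx-adj⇔ : ∀ v w → Adj (Kx as x) (toKx v) (toKx w) ⇔ (v ≢ w × Apart v w)
  Kx-adj⇔ v w rewrite label-toKx v | label-toKx w = mk⇔
    (λ h → let (h₁ , h₂) = to T-∧ h in toWitnessFalse h₁ ∘ cong toKx , from (Apart⇔ v w) h₂)
    (λ (v≢w , apart) → from T-∧ (fromWitnessFalse (v≢w ∘ toKx-injective) , to (Apart⇔ v w) apart))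

  Kx-⊆ : ∀ {G} (e : KxVertex → Fin (order G)) → Injective _≡_ _≡_ e →
         (∀ v w → v ≢ w → Apart v w → Adj G (e v) (e w)) → Kx as x ⊆ G
  Kx-⊆ {G} e e-injective e-adj =
    e ∘ fromKx , (λ eq → fromKx-injective (e-injective eq)) , e∘fromKx-adj
    where
    e∘fromKx-adj : ∀ i j → Adj (Kx as x) i j → Adj G (e (fromKx i)) (e (fromKx j))
    e∘fromKx-adj i j h = uncurry (e-adj (fromKx i) (fromKx j)) (to (Kx-adj⇔ (fromKx i) (fromKx j))
      (subst₂ (Adj (Kx as x)) (sym (toKx-fromKx i)) (sym (toKx-fromKx j)) h))

  Kx-Adj⁼ : ∀ v w → Apart v w → Adj⁼ (Kx as x) (toKx v) (toKx w)
  Kx-Adj⁼ v w apart with toKx v ≟ toKx w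
  ... | yes eq = subst (Adj⁼ (Kx as x) (toKx v)) eq same
  ... | no ne  = edge (from (Kx-adj⇔ v w) (ne ∘ cong toKx , apart))

  at : (j : Fin d) → Fin (lookup as j) ⊎ Fin x → KxVertex
  at j = Sum.map₁ (j ,_)

  at-apart : ∀ {j j′} → j ≢ j′ → ∀ c c′ → Apart (at j c) (at j′ c′)
  at-apart j≢j′ (inj₁ _) (inj₁ _) = j≢j′
  at-apart j≢j′ (inj₁ _) (inj₂ _) = tt
  at-apart j≢j′ (inj₂ _) (inj₁ _) = tt
  at-apart j≢j′ (inj₂ _) (inj₂ _) = tt

  at-Adj⁼ : ∀ {j j′} → j ≢ j′ → ∀ c c′ → Adj⁼ (Kx as x) (toKx (at j c)) (toKx (at j′ c′))
  at-Adj⁼ j≢j′ c c′ = Kx-Adj⁼ (at _ c) (at _ c′) (at-apart j≢j′ c c′)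

open KxVertices using (KxVertex; toKx; toKx-injective; Apart; at)

K-adj : ∀ {d} (ns : Vec ℕ d) (p q : Part ns) → proj₁ p ≢ proj₁ q →
        Adj (K ns) (toKx ns 0 (inj₁ p)) (toKx ns 0 (inj₁ q))
K-adj ns p q ne = from (KxVertices.Kx-adj⇔ ns 0 (inj₁ p) (inj₁ q)) ((λ { refl → ne refl }) , ne)

K-⊆ : ∀ {d} (ns : Vec ℕ d) {G} (φ : Part ns → Fin (order G)) → Injective _≡_ _≡_ φ →
      (∀ p q → proj₁ p ≢ proj₁ q → Adj G (φ p) (φ q)) → K ns ⊆ G
K-⊆ ns {G} φ φ-injective φ-adj = KxVertices.Kx-⊆ ns 0 {G} [ φ , (λ ()) ] injective apart-adj
  where
  injective : Injective _≡_ _≡_ [ φ , (λ ()) ]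
  injective {inj₁ p} {inj₁ q} eq = cong inj₁ (φ-injective eq)
  injective {inj₂ ()}
  injective {_} {inj₂ ()}
  apart-adj : ∀ v w → v ≢ w → Apart ns 0 v w → _
  apart-adj (inj₁ p) (inj₁ q) _ = φ-adj p q

coords : ∀ G₁ G₂ → Fin (order (G₁ ⊠ G₂)) → Fin (order G₁) × Fin (order G₂)
coords G₁ G₂ = remQuot {order G₁} (order G₂)

coords-injective : ∀ G₁ G₂ → Injective _≡_ _≡_ (coords G₁ G₂)
coords-injective G₁ G₂ =
  strictlyInverseʳ⇒injective (coords G₁ G₂) (uncurry combine) (combine-remQuot {order G₁} (order G₂))

⊠-adjP⇒ : ∀ {G₁ G₂ a b v u} → T (⊠-adjP G₁ G₂ (a , v) (b , u)) → Adj⁼ G₁ a b × Adj⁼ G₂ v u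
⊠-adjP⇒ {G₁} {G₂} {a} {b} {v} {u} h with to (T-∨ {eqF a b ∧ adj G₂ v u}) h
... | inj₁ h₁ = let (a≡b , vu) = to (T-∧ {eqF a b}) h₁ in reflexive (toWitness a≡b) , edge vu
... | inj₂ h₂ with to (T-∨ {adj G₁ a b ∧ eqF v u}) h₂
... | inj₁ h₃ = let (ab , v≡u) = to (T-∧ {adj G₁ a b}) h₃ in edge ab , reflexive (toWitness v≡u)
... | inj₂ h₄ = Product.map edge edge (to (T-∧ {adj G₁ a b}) h₄)

⊠-adj⇒ : ∀ {G₁ G₂ i j} → Adj (G₁ ⊠ G₂) i j →
         Adj⁼ G₁ (proj₁ (coords G₁ G₂ i)) (proj₁ (coords G₁ G₂ j)) ×
         Adj⁼ G₂ (proj₂ (coords G₁ G₂ i)) (proj₂ (coords G₁ G₂ j))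
⊠-adj⇒ {G₁} {G₂} = ⊠-adjP⇒ {G₁} {G₂}

⊠-adjP⇐ : ∀ {G₁ G₂ a b v u} → (a , v) ≢ (b , u) → Adj⁼ G₁ a b → Adj⁼ G₂ v u →
          T (⊠-adjP G₁ G₂ (a , v) (b , u))
⊠-adjP⇐ ne same same = ⊥-elim (ne refl)
⊠-adjP⇐ {G₂ = G₂} {a = a} {v = v} {u} ne same (edge vu) =
  from (T-∨ {eqF a a ∧ adj G₂ v u}) (inj₁ (from (T-∧ {eqF a a}) (fromWitness refl , vu)))
⊠-adjP⇐ {G₁} {G₂} {a} {b} {v} ne (edge ab) same =
  from (T-∨ {eqF a b ∧ adj G₂ v v}) (inj₂ (from (T-∨ {adj G₁ a b ∧ eqF v v})
    (inj₁ (from (T-∧ {adj G₁ a b}) (ab , fromWitness refl)))))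
⊠-adjP⇐ {G₁} {G₂} {a} {b} {v} {u} ne (edge ab) (edge vu) =
  from (T-∨ {eqF a b ∧ adj G₂ v u}) (inj₂ (from (T-∨ {adj G₁ a b ∧ eqF v u})
    (inj₂ (from (T-∧ {adj G₁ a b}) (ab , vu)))))

⊠-adj⇐ : ∀ {G₁ G₂ a b v u} → (a , v) ≢ (b , u) → Adj⁼ G₁ a b → Adj⁼ G₂ v u →
         Adj (G₁ ⊠ G₂) (combine a v) (combine b u)
⊠-adj⇐ {G₁} {G₂} {a} {b} {v} {u} ne h₁ h₂ =
  subst₂ (λ p q → T (⊠-adjP G₁ G₂ p q))
    (sym (remQuot-combine {order G₁} a v)) (sym (remQuot-combine {order G₁} b u))
    (⊠-adjP⇐ {G₁} {G₂} ne h₁ h₂)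

record KxFactorisation {d} (ns : Vec ℕ d) (G : Graph) (π : Part ns → Fin (order G)) : Set where
  field
    as : Vec ℕ d
    x : ℕ
    embed : KxVertex as x → Fin (order G)
    embed-injective : Injective _≡_ _≡_ embed
    embed-adj : ∀ v w → v ≢ w → Apart as x v w → Adj G (embed v) (embed w)
    classify : ∀ j → Fin (lookup ns j) → Fin (lookup as j) ⊎ Fin x
    embed-classify : ∀ j k → embed (at as x j (classify j k)) ≡ π (j , k)

  Kx⊆G : Kx as x ⊆ G
  Kx⊆G = KxVertices.Kx-⊆ as x {G} embed embed-injective embed-adj

module _ {d} (ns : Vec ℕ d) (G : Graph) (π : Part ns → Fin (order G))
  (π-compatible : ∀ p q → proj₁ p ≢ proj₁ q → Adj⁼ G (π p) (π q)) where

  private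
    Hit : Fin d → Fin (order G) → Set
    Hit j a = ∃ λ k → π (j , k) ≡ a

    hit? : ∀ j a → Dec (Hit j a)
    hit? j a = any? λ k → π (j , k) ≟ a

    -- Shared vertices form the clique X, and those of Own j the independent set A_j.
    Shared : Fin (order G) → Set
    Shared a = ∃₂ λ j j′ → j ≢ j′ × Hit j a × Hit j′ a

    shared? : ∀ a → Dec (Shared a)
    shared? a = any? λ j → any? λ j′ → ¬? (j ≟ j′) ×-dec hit? j a ×-dec hit? j′ a

    Own : Fin d → Fin (order G) → Set
    Own j a = Hit j a × ¬ Shared a

    own? : ∀ j a → Dec (Own j a)
    own? j a = hit? j a ×-dec ¬? (shared? a)

    hit-Adj⁼ : ∀ {j j′ a b} → Hit j a → Hit j′ b → j ≢ j′ → Adj⁼ G a b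
    hit-Adj⁼ (k , refl) (k′ , refl) = π-compatible (_ , k) (_ , k′)

    shared-avoiding : ∀ {a} → Shared a → ∀ l → ∃ λ j → j ≢ l × Hit j a
    shared-avoiding (j₁ , j₂ , j₁≢j₂ , h₁ , h₂) l with j₁ ≟ l
    ... | no j₁≢l  = j₁ , j₁≢l , h₁
    ... | yes refl = j₂ , j₁≢j₂ ∘ sym , h₂

    x : ℕ
    x = proj₁ (enumerate shared?)

    shared : Enumeration Shared x
    shared = proj₂ (enumerate shared?)

    ownCount : Fin d → ℕ
    ownCount j = proj₁ (enumerate (own? j))

    as : Vec ℕ d
    as = tabulate ownCount

    own : ∀ j → Enumeration (Own j) (lookup as j)
    own j = subst (Enumeration (Own j)) (sym (lookup∘tabulate ownCount j)) (proj₂ (enumerate (own? j)))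

    open Enumeration

    embed : KxVertex as x → Fin (order G)
    embed (inj₁ (j , α)) = enum (own j) α
    embed (inj₂ s) = enum shared s

    own-hit : ∀ j α → Hit j (embed (inj₁ (j , α)))
    own-hit j α = proj₁ (enum-∈ (own j) α)

    own-unshared : ∀ j α → ¬ Shared (embed (inj₁ (j , α)))
    own-unshared j α = proj₂ (enum-∈ (own j) α)

    embed-injective : Injective _≡_ _≡_ embed
    embed-injective {inj₁ (j , α)} {inj₁ (j′ , α′)} eq with j ≟ j′
    ... | yes refl = cong (λ α → inj₁ (j , α)) (enum-injective (own j) eq)
    ... | no j≢j′ =
      ⊥-elim (own-unshared j α (j , j′ , j≢j′ , own-hit j α , subst (Hit j′) (sym eq) (own-hit j′ α′)))
    embed-injective {inj₁ (j , α)} {inj₂ s} eq =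
      ⊥-elim (own-unshared j α (subst Shared (sym eq) (enum-∈ shared s)))
    embed-injective {inj₂ s} {inj₁ (j , α)} eq =
      ⊥-elim (own-unshared j α (subst Shared eq (enum-∈ shared s)))
    embed-injective {inj₂ s} {inj₂ t} eq = cong inj₂ (enum-injective shared eq)

    apart-hits : ∀ v w → Apart as x v w →
                 ∃₂ λ j j′ → j ≢ j′ × Hit j (embed v) × Hit j′ (embed w)
    apart-hits (inj₁ (j , α)) (inj₁ (j′ , α′)) j≢j′ = j , j′ , j≢j′ , own-hit j α , own-hit j′ α′
    apart-hits (inj₁ (j , α)) (inj₂ s) _ =
      let (j′ , j′≢j , h) = shared-avoiding (enum-∈ shared s) j
      in j , j′ , j′≢j ∘ sym , own-hit j α , h
    apart-hits (inj₂ s) (inj₁ (j , α)) _ =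
      let (j′ , j′≢j , h) = shared-avoiding (enum-∈ shared s) j
      in j′ , j , j′≢j , h , own-hit j α
    apart-hits (inj₂ s) (inj₂ t) _ =
      let (l , _ , _ , hₗ , _) = enum-∈ shared t
          (j , j≢l , h) = shared-avoiding (enum-∈ shared s) l
      in j , l , j≢l , h , hₗ

    embed-adj : ∀ v w → v ≢ w → Apart as x v w → Adj G (embed v) (embed w)
    embed-adj v w v≢w apart =
      let (_ , _ , j≢j′ , h , h′) = apart-hits v w apart
      in Adj⁼⇒Adj {G} (hit-Adj⁼ h h′ j≢j′) (v≢w ∘ embed-injective)

    classifyBy : ∀ j k → Dec (Shared (π (j , k))) → Fin (lookup as j) ⊎ Fin x
    classifyBy j k (yes sh) = inj₂ (index shared _ sh)
    classifyBy j k (no ¬sh) = inj₁ (index (own j) _ ((k , refl) , ¬sh))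

    embed-classifyBy : ∀ j k s → embed (at as x j (classifyBy j k s)) ≡ π (j , k)
    embed-classifyBy j k (yes sh) = enum-index shared _ sh
    embed-classifyBy j k (no ¬sh) = enum-index (own j) _ _

  kxFactorisation : KxFactorisation ns G π
  kxFactorisation = record
    { as = as ; x = x ; embed = embed ; embed-injective = embed-injective ; embed-adj = embed-adj
    ; classify = λ j k → classifyBy j k (shared? (π (j , k)))
    ; embed-classify = λ j k → embed-classifyBy j k (shared? (π (j , k)))
    }

module Cells {d} (as bs : Vec ℕ d) (x y : ℕ) where

  -- The cells of (A_j ⊎ X) × (B_j ⊎ Y) outside X × Y, grouped as in a_j b_j + a_j y + b_j x.
  Cell : Fin d → Set
  Cell j = (Fin a × Fin b ⊎ Fin a × Fin y) ⊎ Fin b × Fin x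
    where a = lookup as j
          b = lookup bs j

  cellCount : Fin d → ℕ
  cellCount j = a * b + a * y + b * x
    where a = lookup as j
          b = lookup bs j

  Cell↔ : ∀ j → Fin (cellCount j) ↔ Cell j
  Cell↔ j = ↔-trans +↔⊎ (↔-trans +↔⊎ (*↔× ⊎-↔ *↔×) ⊎-↔ *↔×)

  Pair : Fin d → Set
  Pair j = (Fin (lookup as j) ⊎ Fin x) × (Fin (lookup bs j) ⊎ Fin y)

  regroup : ∀ j → Pair j → Cell j ⊎ Fin x × Fin y
  regroup j (inj₁ α , inj₁ β) = inj₁ (inj₁ (inj₁ (α , β)))
  regroup j (inj₁ α , inj₂ t) = inj₁ (inj₁ (inj₂ (α , t)))
  regroup j (inj₂ s , inj₁ β) = inj₁ (inj₂ (β , s))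
  regroup j (inj₂ s , inj₂ t) = inj₂ (s , t)

  ungroup : ∀ j → Cell j ⊎ Fin x × Fin y → Pair j
  ungroup j (inj₁ (inj₁ (inj₁ (α , β)))) = inj₁ α , inj₁ β
  ungroup j (inj₁ (inj₁ (inj₂ (α , t)))) = inj₁ α , inj₂ t
  ungroup j (inj₁ (inj₂ (β , s))) = inj₂ s , inj₁ β
  ungroup j (inj₂ (s , t)) = inj₂ s , inj₂ t

  ungroup-regroup : ∀ j c → ungroup j (regroup j c) ≡ c
  ungroup-regroup j (inj₁ α , inj₁ β) = refl
  ungroup-regroup j (inj₁ α , inj₂ t) = refl
  ungroup-regroup j (inj₂ s , inj₁ β) = refl
  ungroup-regroup j (inj₂ s , inj₂ t) = refl

  Vertex² : Set
  Vertex² = KxVertex as x × KxVertex bs y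

  atPair : ∀ j → Pair j → Vertex²
  atPair j = Product.map (at as x j) (at bs y j)

  cell : Σ (Fin d) Cell ⊎ Fin x × Fin y → Vertex²
  cell (inj₁ (j , c)) = atPair j (ungroup j (inj₁ c))
  cell (inj₂ (s , t)) = inj₂ s , inj₂ t

  cell-tagged : ∀ j c → cell (Sum.map₁ (j ,_) c) ≡ atPair j (ungroup j c)
  cell-tagged j (inj₁ c) = refl
  cell-tagged j (inj₂ c) = refl

  uncell : Vertex² → Maybe (Σ (Fin d) Cell ⊎ Fin x × Fin y)
  uncell (inj₁ (j , α) , inj₁ (j′ , β)) with j ≟ j′
  ... | yes refl = just (inj₁ (j , inj₁ (inj₁ (α , β))))
  ... | no _     = nothing
  uncell (inj₁ (j , α) , inj₂ t) = just (inj₁ (j , inj₁ (inj₂ (α , t))))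
  uncell (inj₂ s , inj₁ (j , β)) = just (inj₁ (j , inj₂ (β , s)))
  uncell (inj₂ s , inj₂ t) = just (inj₂ (s , t))

  uncell-cell : ∀ c → uncell (cell c) ≡ just c
  uncell-cell (inj₁ (j , inj₁ (inj₁ (α , β)))) with j ≟ j
  ... | yes refl = refl
  ... | no j≢j   = ⊥-elim (j≢j refl)
  uncell-cell (inj₁ (j , inj₁ (inj₂ (α , t)))) = refl
  uncell-cell (inj₁ (j , inj₂ (β , s))) = refl
  uncell-cell (inj₂ (s , t)) = refl

  cell-injective : Injective _≡_ _≡_ cell
  cell-injective {c} {c′} eq =
    just-injective (trans (sym (uncell-cell c)) (trans (cong uncell eq) (uncell-cell c′)))

module Forward {d} {ns : Vec ℕ d} {G₁ G₂ : Graph} (F : K ns ⊆ (G₁ ⊠ G₂)) where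

  π : Part ns → Fin (order G₁) × Fin (order G₂)
  π p = coords G₁ G₂ (proj₁ F (toKx ns 0 (inj₁ p)))

  π-injective : Injective _≡_ _≡_ π
  π-injective eq =
    inj₁-injective (toKx-injective ns 0 (proj₁ (proj₂ F) (coords-injective G₁ G₂ eq)))

  π-compatible : ∀ p q → proj₁ p ≢ proj₁ q →
    Adj⁼ G₁ (proj₁ (π p)) (proj₁ (π q)) × Adj⁼ G₂ (proj₂ (π p)) (proj₂ (π q))
  π-compatible p q p≢q = ⊠-adj⇒ {G₁} {G₂} (proj₂ (proj₂ F) _ _ (K-adj ns p q p≢q))

  module T₁ = KxFactorisation (kxFactorisation ns G₁ (proj₁ ∘ π) λ p q → proj₁ ∘ π-compatible p q)
  module T₂ = KxFactorisation (kxFactorisation ns G₂ (proj₂ ∘ π) λ p q → proj₂ ∘ π-compatible p q)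
  open Cells T₁.as T₂.as T₁.x T₂.x

  cellOf : ∀ j → Fin (lookup ns j) → Cell j ⊎ Fin T₁.x × Fin T₂.x
  cellOf j k = regroup j (T₁.classify j k , T₂.classify j k)

  embed-cell : ∀ p → Product.map T₁.embed T₂.embed (cell (tagged cellOf p)) ≡ π p
  embed-cell (j , k)
    rewrite cell-tagged j (cellOf j k) | ungroup-regroup j (T₁.classify j k , T₂.classify j k)
    = cong₂ _,_ (T₁.embed-classify j k) (T₂.embed-classify j k)

  cellOf-injective : Injective _≡_ _≡_ (tagged cellOf)
  cellOf-injective {p} {q} eq = π-injective
    (trans (sym (embed-cell p)) (trans (cong (Product.map T₁.embed T₂.embed ∘ cell) eq) (embed-cell q)))

  open Counting (λ j → ↔⇒↣ (↔-sym (Cell↔ j))) (↔⇒↣ (↔-sym *↔×)) cellOf cellOf-injective public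

module Backward {d} (ns as bs zs : Vec ℕ d) (x y : ℕ) {G₁ G₂ : Graph}
  (E₁ : Kx as x ⊆ G₁) (E₂ : Kx bs y ⊆ G₂)
  (ns≤ : ∀ j → lookup ns j ≤ Cells.cellCount as bs x y j + lookup zs j)
  (sum-zs≤xy : sum zs ≤ x * y) where
  open Cells as bs x y
  open Packing {zs = zs} (λ j → ↔⇒↣ (Cell↔ j)) (↔⇒↣ (*↔× {x} {y})) ns≤ sum-zs≤xy

  vertices : Part ns → Vertex²
  vertices (j , k) = atPair j (ungroup j (pack j k))

  vertices-injective : Injective _≡_ _≡_ vertices
  vertices-injective {j , k} {j′ , k′} eq = pack-injective
    (cell-injective (trans (cell-tagged j (pack j k)) (trans eq (sym (cell-tagged j′ (pack j′ k′))))))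

  images : Part ns → Fin (order G₁) × Fin (order G₂)
  images = Product.map (proj₁ E₁ ∘ toKx as x) (proj₁ E₂ ∘ toKx bs y) ∘ vertices

  images-injective : Injective _≡_ _≡_ images
  images-injective eq = vertices-injective (cong₂ _,_
    (toKx-injective as x (proj₁ (proj₂ E₁) (cong proj₁ eq)))
    (toKx-injective bs y (proj₁ (proj₂ E₂) (cong proj₂ eq))))

  images-adjacent : ∀ p q → proj₁ p ≢ proj₁ q →
                    Adj (G₁ ⊠ G₂) (uncurry combine (images p)) (uncurry combine (images q))
  images-adjacent (j , k) (j′ , k′) j≢j′ = ⊠-adj⇐ {G₁} {G₂} (j≢j′ ∘ cong proj₁ ∘ images-injective)
    (⊆-Adj⁼ {Kx as x} {G₁} E₁ (KxVertices.at-Adj⁼ as x j≢j′ (proj₁ c) (proj₁ c′)))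
    (⊆-Adj⁼ {Kx bs y} {G₂} E₂ (KxVertices.at-Adj⁼ bs y j≢j′ (proj₂ c) (proj₂ c′)))
    where
    c = ungroup j (pack j k)
    c′ = ungroup j′ (pack j′ k′)

  K⊆G₁⊠G₂ : K ns ⊆ (G₁ ⊠ G₂)
  K⊆G₁⊠G₂ = K-⊆ ns {G₁ ⊠ G₂} (uncurry combine ∘ images)
    (λ eq → images-injective (uncurry (cong₂ _,_) (combine-injective _ _ _ _ eq))) images-adjacent

theorem8 : (d : ℕ) → 2 ≤ d → (ns : Vec ℕ d) → (∀ j → 1 ≤ lookup ns j) →
    (G₁ G₂ : Graph) →
    (K ns ⊆ (G₁ ⊠ G₂)) ⇔
    (Σ (Vec ℕ d) λ as → Σ (Vec ℕ d) λ bs → Σ (Vec ℕ d) λ zs → Σ ℕ λ x → Σ ℕ λ y →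
      (Kx as x ⊆ G₁) × (Kx bs y ⊆ G₂) ×
      (∀ j → lookup ns j ≤ lookup as j * lookup bs j + lookup as j * y
                           + lookup bs j * x + lookup zs j) ×
      (sum zs ≤ x * y))
theorem8 _ _ ns _ G₁ G₂ = mk⇔
  (λ F → let open Forward {ns = ns} {G₁ = G₁} {G₂ = G₂} F
         in T₁.as , T₂.as , zs , T₁.x , T₂.x , T₁.Kx⊆G , T₂.Kx⊆G , n≤m+zs , sum-zs≤N)
  (λ (as , bs , zs , x , y , E₁ , E₂ , ns≤ , sum-zs≤xy) →
     Backward.K⊆G₁⊠G₂ ns as bs zs x y {G₁} {G₂} E₁ E₂ ns≤ sum-zs≤xy)
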